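{- Let $r\ge5$, let $A$ be an independent set in $G(n,r,1)$, with $A_0=\{v_1,\dots,v_k\}$, $I_0$ and $A_1$ as defined in the context, fix $x\in[n]\setminus I_0$, and let $B_i$, $f$ and $\omega$ be as defined in the context. If $i\neq j$, $B_i\neq\emptyset$ and $|B_j|\ge\omega$, then $f(u_1)\cap f(u_2)\neq\emptyset$ for all $u_1,u_2\in B_i$.
   Context: $G(n,r,1)$ is the graph whose vertex set is the family of all $r$-element subsets of $[n]=\{1,\dots,n\}$, two vertices being adjacent iff they intersect in exactly one element. Given an independent set $A$, let $A_0=\{v_1,\dots,v_k\}\subseteq A$ be a subfamily of maximum size among subfamilies of $A$ consisting of pairwise disjoint sets, $I_0=v_1\cup\dots\cup v_k$, and $A_1$ the set of $v\in A\setminus A_0$ intersecting exactly one of $v_1,\dots,v_k$. $\omega=r^5\binom{n}{r-5}$. For the fixed element $x$, $B_i=\{v\in A_1: x\in v,\ v\cap v_i\neq\emptyset\}$. For each $v\in B_i$ choose two distinct elements $y,z\in v\cap v_i$ (any choice) and set $f(v)=v\setminus\{x,y,z\}$, a set of size $r-3$. -}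

module Defs where

open import Data.Nat using (ℕ; _*_; _^_; _∸_; _≤_)
open import Data.Nat.Combinatorics using (_C_)
open import Data.Fin using (Fin)
open import Data.Fin.Subset using (Subset; _∈_; _∉_; _∩_; _-_; ∣_∣; Nonempty; Empty)
open import Data.List using (List; length)
open import Data.List.Relation.Unary.All using (All)
open import Data.List.Relation.Unary.Unique.Propositional using (Unique)
open import Data.List.Relation.Unary.AllPairs using (AllPairs)
open import Data.Product using (Σ; ∃; _×_)
open import Relation.Binary.PropositionalEquality using (_≡_; _≢_)

-- A family of subsets of [n] = Fin n is a predicate on Subset n
-- (automatically finite, since Subset n is finite).
Family : ℕ → Set₁
Family n = Subset n → Set

AtLeast : ∀ {n} → ℕ → Family n → Set
AtLeast {n} m F = Σ (List (Subset n)) λ L → Unique L × All F L × m ≤ length L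

Vertices : ∀ {n} → ℕ → Family n → Set
Vertices r A = ∀ v → A v → ∣ v ∣ ≡ r

-- A is independent in G(n,r,1): no two members meet in exactly one element.
Independent : ∀ {n} → Family n → Set
Independent A = ∀ u w → A u → A w → ∣ u ∩ w ∣ ≢ 1

PairwiseDisjoint : ∀ {n} → List (Subset n) → Set
PairwiseDisjoint = AllPairs (λ u w → Empty (u ∩ w))

IsMaxDisjoint : ∀ {n k} → Family n → (Fin k → Subset n) → Set
IsMaxDisjoint {n} {k} A vs =
  (∀ i → A (vs i)) ×
  (∀ i j → i ≢ j → Empty (vs i ∩ vs j)) ×
  (∀ (L : List (Subset n)) → Unique L → All A L → PairwiseDisjoint L → length L ≤ k)

-- x ∈ [n] \ I₀ where I₀ = v₁ ∪ … ∪ v_k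
OutsideI₀ : ∀ {n k} → (Fin k → Subset n) → Fin n → Set
OutsideI₀ vs x = ∀ i → x ∉ vs i

InA₁ : ∀ {n k} → Family n → (Fin k → Subset n) → Subset n → Set
InA₁ A vs v =
  A v × (∀ i → v ≢ vs i) ×
  ∃ λ i → Nonempty (v ∩ vs i) × (∀ i′ → Nonempty (v ∩ vs i′) → i′ ≡ i)

InB : ∀ {n k} → Family n → (Fin k → Subset n) → Fin n → Fin k → Subset n → Set
InB A vs x i v = InA₁ A vs v × x ∈ v × Nonempty (v ∩ vs i)

IsChoiceF : ∀ {n k} → Family n → (Fin k → Subset n) → Fin n → Fin k
          → (Subset n → Subset n) → Set
IsChoiceF A vs x i f =
  ∀ v → InB A vs x i v →
    ∃ λ y → ∃ λ z → y ≢ z × y ∈ (v ∩ vs i) × z ∈ (v ∩ vs i) ×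
      f v ≡ ((v - x) - y) - z

ω : ℕ → ℕ → ℕ
ω n r = r ^ 5 * (n C (r ∸ 5))

module Submission where

-- Suppose, for a contradiction, that f(u₁) ∩ f(u₂) = ∅.  Every w ∈ B_j then
-- contains five distinct points: x; a second common point a of w and u₁ and b of
-- w and u₂ (independence forbids |w ∩ u| = 1, and x lies in both); two points
-- c ≠ d of w ∩ v_j.  Here a ≠ b since a ∈ f(u₁) and b ∈ f(u₂), while c and d
-- differ from a, b and x because members of A₁ meet only one vᵢ and x ∉ I₀.
-- Hence w is determined by a choice from {x} × u₁ × u₂ × v_j × v_j together with
-- the (r-5)-set of its remaining points, so |B_j| ≤ r⁴·C(n,r-5) < ω.

open import Defs

open import Data.Nat using (ℕ; zero; suc; _+_; _*_; _^_; _∸_; _≤_; _<_; z≤n; s≤s)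
open import Data.Nat.Properties
open import Data.Nat.Combinatorics using (_C_; nCk+nC[k+1]≡[n+1]C[k+1])
open import Data.Fin using (Fin; zero; suc)
open import Data.Fin.Properties using () renaming (_≟_ to _≟ᶠ_)
open import Data.Fin.Subset
  using (Subset; outside; inside; ⊥; _∈_; _∉_; _∩_; _∪_; _-_; ⁅_⁆; ∣_∣; Nonempty; Empty)
open import Data.Fin.Subset.Properties
  using ( x∈p∩q⁺; x∈p∩q⁻; x∈p∪q⁺; x∈p∪q⁻; x∈⁅x⁆; x∈⁅y⁆⇒x≡y; x∈p∧x≢y⇒x∈p-y; p─q⊆p
        ; p─⊥≡p; ⊆-antisym; nonempty?; Empty-unique; ∣⊥∣≡0; ∣⁅x⁆∣≡1; ∣p∣≤n)
open import Data.Vec.Base using ([]; _∷_; here; there)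
open import Data.List using (List; []; _∷_; [_]; _++_; length; map; concatMap)
open import Data.Nat.ListAction using (product)
open import Data.List.Properties using (length-map; length-++; length-++-sucʳ)
open import Data.List.Membership.Propositional using () renaming (_∈_ to _∈ᴸ_)
open import Data.List.Membership.Propositional.Properties
  using (∈-map⁺; ∈-++⁺ˡ; ∈-++⁺ʳ; ∈-++⁻; ∈-∃++; ∈-concatMap⁺)
open import Data.List.Relation.Unary.All as All using (All; []; _∷_)
open import Data.List.Relation.Unary.Any as Any using (here; there)
open import Data.List.Relation.Unary.AllPairs using ([]; _∷_)
open import Data.List.Relation.Unary.Unique.Propositional using (Unique)
open import Data.List.Relation.Binary.Pointwise using (Pointwise; []; _∷_)
open import Data.Product using (∃; _×_; _,_; proj₂)
open import Data.Sum using (inj₁; inj₂)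
open import Data.Empty using (⊥-elim)
open import Relation.Nullary using (yes; no)
open import Relation.Binary.PropositionalEquality
  using (_≡_; _≢_; refl; sym; trans; cong; cong₂; subst; ≢-sym; module ≡-Reasoning)

unique-⊆-length : ∀ {A : Set} {L M : List A} → Unique L
                → (∀ {a} → a ∈ᴸ L → a ∈ᴸ M) → length L ≤ length M
unique-⊆-length {L = []}    _             _   = z≤n
unique-⊆-length {L = a ∷ L} (a∉L ∷ uniq) L⊆M with ∈-∃++ (L⊆M (here refl))
... | M₁ , M₂ , refl = begin
  suc (length L)            ≤⟨ s≤s (unique-⊆-length uniq L⊆M₁M₂) ⟩
  suc (length (M₁ ++ M₂))   ≡⟨ length-++-sucʳ M₁ a M₂ ⟨
  length (M₁ ++ a ∷ M₂)     ∎
  where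
  open ≤-Reasoning
  -- the members of L avoid the displayed copy of a, by uniqueness
  L⊆M₁M₂ : ∀ {b} → b ∈ᴸ L → b ∈ᴸ M₁ ++ M₂
  L⊆M₁M₂ b∈L with ∈-++⁻ M₁ (L⊆M (there b∈L))
  ... | inj₁ b∈M₁         = ∈-++⁺ˡ b∈M₁
  ... | inj₂ (here refl)  = ⊥-elim (All.lookup a∉L b∈L refl)
  ... | inj₂ (there b∈M₂) = ∈-++⁺ʳ M₁ b∈M₂

length-concatMap : ∀ {A B : Set} (g : A → List B) {m} → (∀ a → length (g a) ≡ m)
                 → ∀ xs → length (concatMap g xs) ≡ length xs * m
length-concatMap g eq []       = refl
length-concatMap g eq (x ∷ xs) =
  trans (length-++ (g x)) (cong₂ _+_ (eq x) (length-concatMap g eq xs))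

elements : ∀ {n} → Subset n → List (Fin n)
elements []            = []
elements (outside ∷ p) = map suc (elements p)
elements (inside ∷ p)  = zero ∷ map suc (elements p)

length-elements : ∀ {n} (p : Subset n) → length (elements p) ≡ ∣ p ∣
length-elements []            = refl
length-elements (outside ∷ p) = trans (length-map suc (elements p)) (length-elements p)
length-elements (inside ∷ p)  = cong suc (trans (length-map suc (elements p)) (length-elements p))

∈-elements : ∀ {n} (p : Subset n) {q} → q ∈ p → q ∈ᴸ elements p
∈-elements (inside ∷ p)  here      = here refl
∈-elements (outside ∷ p) (there m) = ∈-map⁺ suc (∈-elements p m)
∈-elements (inside ∷ p)  (there m) = there (∈-map⁺ suc (∈-elements p m))

subsetsOfSize : (n k : ℕ) → List (Subset n)
subsetsOfSize zero    zero    = [ [] ]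
subsetsOfSize zero    (suc k) = []
subsetsOfSize (suc n) zero    = map (outside ∷_) (subsetsOfSize n zero)
subsetsOfSize (suc n) (suc k) =
  map (inside ∷_) (subsetsOfSize n k) ++ map (outside ∷_) (subsetsOfSize n (suc k))

length-subsetsOfSize : ∀ n k → length (subsetsOfSize n k) ≡ n C k
length-subsetsOfSize zero    zero    = refl
length-subsetsOfSize zero    (suc k) = refl
length-subsetsOfSize (suc n) zero    =
  trans (length-map _ (subsetsOfSize n zero)) (length-subsetsOfSize n zero)
length-subsetsOfSize (suc n) (suc k) = begin
  length (map (inside ∷_) (subsetsOfSize n k) ++ map (outside ∷_) (subsetsOfSize n (suc k)))
    ≡⟨ length-++ (map (inside ∷_) (subsetsOfSize n k)) ⟩
  length (map (inside ∷_) (subsetsOfSize n k)) + length (map (outside ∷_) (subsetsOfSize n (suc k)))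
    ≡⟨ cong₂ _+_ (length-map _ (subsetsOfSize n k)) (length-map _ (subsetsOfSize n (suc k))) ⟩
  length (subsetsOfSize n k) + length (subsetsOfSize n (suc k))
    ≡⟨ cong₂ _+_ (length-subsetsOfSize n k) (length-subsetsOfSize n (suc k)) ⟩
  n C k + n C suc k
    ≡⟨ nCk+nC[k+1]≡[n+1]C[k+1] n k ⟩
  suc n C suc k ∎
  where open ≡-Reasoning

∈-subsetsOfSize : ∀ {n} (p : Subset n) → p ∈ᴸ subsetsOfSize n ∣ p ∣
∈-subsetsOfSize []                      = here refl
∈-subsetsOfSize {suc n} (inside ∷ p)    = ∈-++⁺ˡ (∈-map⁺ (inside ∷_) (∈-subsetsOfSize p))
∈-subsetsOfSize {suc n} (outside ∷ p) with ∣ p ∣ | ∈-subsetsOfSize p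
... | zero  | p∈ = ∈-map⁺ (outside ∷_) p∈
... | suc c | p∈ = ∈-++⁺ʳ (map (inside ∷_) (subsetsOfSize n c)) (∈-map⁺ (outside ∷_) p∈)

1≤nCk : ∀ {n k} → k ≤ n → 1 ≤ n C k
1≤nCk {n}     {zero}  _         = ≤-refl
1≤nCk {suc n} {suc k} (s≤s k≤n) = begin
  1                    ≤⟨ 1≤nCk k≤n ⟩
  n C k                ≤⟨ m≤m+n (n C k) (n C suc k) ⟩
  n C k + n C suc k    ≡⟨ nCk+nC[k+1]≡[n+1]C[k+1] n k ⟩
  suc n C suc k        ∎
  where open ≤-Reasoning

choices : ∀ {n} → List (Subset n) → List (List (Fin n))
choices []          = [ [] ]
choices (P ∷ pools) = concatMap (λ p → map (p ∷_) (choices pools)) (elements P)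

length-choices : ∀ {n} (pools : List (Subset n)) → length (choices pools) ≡ product (map ∣_∣ pools)
length-choices []          = refl
length-choices (P ∷ pools) = begin
  length (concatMap (λ p → map (p ∷_) (choices pools)) (elements P))
    ≡⟨ length-concatMap _ (λ p → trans (length-map (p ∷_) (choices pools)) (length-choices pools)) (elements P) ⟩
  length (elements P) * product (map ∣_∣ pools)
    ≡⟨ cong (_* product (map ∣_∣ pools)) (length-elements P) ⟩
  ∣ P ∣ * product (map ∣_∣ pools) ∎
  where open ≡-Reasoning

∈-choices : ∀ {n} {ps : List (Fin n)} {pools} → Pointwise _∈_ ps pools → ps ∈ᴸ choices pools
∈-choices []                                            = here refl
∈-choices {ps = p ∷ ps} {P ∷ pools} (p∈P ∷ ps∈pools) =
  ∈-concatMap⁺ (λ q → map (q ∷_) (choices pools))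
    (Any.map (λ { refl → ∈-map⁺ (p ∷_) (∈-choices ps∈pools) }) (∈-elements P p∈P))

∣p∣≡1+∣p-x∣ : ∀ {n} (p : Subset n) {x} → x ∈ p → ∣ p ∣ ≡ suc ∣ p - x ∣
∣p∣≡1+∣p-x∣ (inside ∷ p)  here      = cong (λ q → suc ∣ q ∣) (sym (p─⊥≡p p))
∣p∣≡1+∣p-x∣ (inside ∷ p)  (there m) = cong suc (∣p∣≡1+∣p-x∣ p m)
∣p∣≡1+∣p-x∣ (outside ∷ p) (there m) = ∣p∣≡1+∣p-x∣ p m

∈p-x⇒≢x : ∀ {n} (p : Subset n) x {y} → y ∈ p - x → y ≢ x
∈p-x⇒≢x (s ∷ p) zero    {zero}  ()
∈p-x⇒≢x (s ∷ p) (suc x) {suc y} (there m) refl = ∈p-x⇒≢x p x m refl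

p-x∪⁅x⁆≡p : ∀ {n} (p : Subset n) {x} → x ∈ p → (p - x) ∪ ⁅ x ⁆ ≡ p
p-x∪⁅x⁆≡p p {x} x∈p = ⊆-antisym ⊆p p⊆
  where
  ⊆p : ∀ {y} → y ∈ (p - x) ∪ ⁅ x ⁆ → y ∈ p
  ⊆p y∈ with x∈p∪q⁻ (p - x) ⁅ x ⁆ y∈
  ... | inj₁ y∈p-x = p─q⊆p p ⁅ x ⁆ y∈p-x
  ... | inj₂ y∈⁅x⁆ = subst (_∈ p) (sym (x∈⁅y⁆⇒x≡y x y∈⁅x⁆)) x∈p
  p⊆ : ∀ {y} → y ∈ p → y ∈ (p - x) ∪ ⁅ x ⁆
  p⊆ {y} y∈p with y ≟ᶠ x
  ... | yes refl = x∈p∪q⁺ (inj₂ (x∈⁅x⁆ x))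
  ... | no y≢x   = x∈p∪q⁺ (inj₁ (x∈p∧x≢y⇒x∈p-y y∈p y≢x))

another-element : ∀ {n} (p : Subset n) {x} → x ∈ p → ∣ p ∣ ≢ 1 → ∃ λ y → y ∈ p × y ≢ x
another-element {n} p {x} x∈p ∣p∣≢1 with nonempty? (p - x)
... | yes (y , y∈) = y , p─q⊆p p ⁅ x ⁆ y∈ , ∈p-x⇒≢x p x y∈
... | no p-x-empty = ⊥-elim (∣p∣≢1 (begin
  ∣ p ∣          ≡⟨ ∣p∣≡1+∣p-x∣ p x∈p ⟩
  suc ∣ p - x ∣  ≡⟨ cong (λ q → suc ∣ q ∣) (Empty-unique p-x-empty) ⟩
  suc ∣ ⊥ {n} ∣  ≡⟨ cong suc (∣⊥∣≡0 n) ⟩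
  1              ∎))
  where open ≡-Reasoning

insertAll : ∀ {n} → List (Fin n) → Subset n → Subset n
insertAll []       S = S
insertAll (p ∷ ps) S = insertAll ps S ∪ ⁅ p ⁆

removeAll : ∀ {n} → List (Fin n) → Subset n → Subset n
removeAll []       w = w
removeAll (p ∷ ps) w = removeAll ps (w - p)

All-∈-remove : ∀ {n} {w : Subset n} {p ps} → All (p ≢_) ps → All (_∈ w) ps → All (_∈ w - p) ps
All-∈-remove p≢ps ps⊆w =
  All.zipWith (λ (p≢q , q∈w) → x∈p∧x≢y⇒x∈p-y q∈w (≢-sym p≢q)) (p≢ps , ps⊆w)

insertAll-removeAll : ∀ {n} {w : Subset n} {ps} → Unique ps → All (_∈ w) ps
                    → insertAll ps (removeAll ps w) ≡ w
insertAll-removeAll {ps = []}                 _             _            = refl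
insertAll-removeAll {w = w} {ps = p ∷ ps} (p≢ps ∷ uniq) (p∈w ∷ ps⊆w) = begin
  insertAll ps (removeAll ps (w - p)) ∪ ⁅ p ⁆
    ≡⟨ cong (_∪ ⁅ p ⁆) (insertAll-removeAll uniq (All-∈-remove p≢ps ps⊆w)) ⟩
  (w - p) ∪ ⁅ p ⁆
    ≡⟨ p-x∪⁅x⁆≡p w p∈w ⟩
  w ∎
  where open ≡-Reasoning

∣removeAll∣ : ∀ {n} {w : Subset n} {ps} → Unique ps → All (_∈ w) ps
            → ∣ w ∣ ≡ length ps + ∣ removeAll ps w ∣
∣removeAll∣ {ps = []}                 _             _            = refl
∣removeAll∣ {w = w} {ps = p ∷ ps} (p≢ps ∷ uniq) (p∈w ∷ ps⊆w) =
  trans (∣p∣≡1+∣p-x∣ w p∈w) (cong suc (∣removeAll∣ uniq (All-∈-remove p≢ps ps⊆w)))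

Marked : ∀ {n} → List (Subset n) → ℕ → Subset n → Set
Marked pools s w =
  ∃ λ ps → Unique ps × Pointwise _∈_ ps pools × All (_∈ w) ps × ∣ w ∣ ≡ length ps + s

candidates : ∀ {n} → List (Subset n) → ℕ → List (Subset n)
candidates {n} pools s = concatMap (λ ps → map (insertAll ps) (subsetsOfSize n s)) (choices pools)

length-candidates : ∀ {n} (pools : List (Subset n)) s
                  → length (candidates pools s) ≡ product (map ∣_∣ pools) * (n C s)
length-candidates {n} pools s = trans
  (length-concatMap _ (λ ps → trans (length-map (insertAll ps) (subsetsOfSize n s)) (length-subsetsOfSize n s)) (choices pools))
  (cong (_* (n C s)) (length-choices pools))

marked⇒candidate : ∀ {n} {pools : List (Subset n)} {s w} → Marked pools s w → w ∈ᴸ candidates pools s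
marked⇒candidate {n} {pools} {s} {w} (ps , uniq , ps∈pools , ps⊆w , ∣w∣≡) =
  ∈-concatMap⁺ (λ qs → map (insertAll qs) (subsetsOfSize n s))
    (Any.map (λ { refl → w∈ }) (∈-choices ps∈pools))
  where
  rest : Subset n
  rest = removeAll ps w
  ∣rest∣≡s : ∣ rest ∣ ≡ s
  ∣rest∣≡s = +-cancelˡ-≡ (length ps) _ _ (trans (sym (∣removeAll∣ uniq ps⊆w)) ∣w∣≡)
  rest∈ : rest ∈ᴸ subsetsOfSize n s
  rest∈ = subst (λ t → rest ∈ᴸ subsetsOfSize n t) ∣rest∣≡s (∈-subsetsOfSize rest)
  w∈ : w ∈ᴸ map (insertAll ps) (subsetsOfSize n s)
  w∈ = subst (_∈ᴸ map (insertAll ps) (subsetsOfSize n s)) (insertAll-removeAll uniq ps⊆w)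
         (∈-map⁺ (insertAll ps) rest∈)

encoding-bound : ∀ {n m} (F : Family n) (pools : List (Subset n)) s
               → (∀ w → F w → Marked pools s w) → AtLeast m F
               → m ≤ product (map ∣_∣ pools) * (n C s)
encoding-bound F pools s marked (L , uniq , L⊆F , m≤∣L∣) = begin
  _                                  ≤⟨ m≤∣L∣ ⟩
  length L                           ≤⟨ unique-⊆-length uniq L⊆candidates ⟩
  length (candidates pools s)        ≡⟨ length-candidates pools s ⟩
  product (map ∣_∣ pools) * (_ C s)   ∎
  where
  open ≤-Reasoning
  L⊆candidates : ∀ {w} → w ∈ᴸ L → w ∈ᴸ candidates pools s
  L⊆candidates w∈L = marked⇒candidate (marked _ (All.lookup L⊆F w∈L))

r⁴c<r⁵c : ∀ {r c} → 2 ≤ r → 1 ≤ c → r ^ 4 * c < r ^ 5 * c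
r⁴c<r⁵c {r} {c} 2≤r 1≤c = begin-strict
  t              <⟨ m<m+n t (*-mono-≤ (^-monoˡ-≤ 4 (≤-trans (s≤s z≤n) 2≤r)) 1≤c) ⟩
  t + t          ≡⟨ cong (t +_) (+-identityʳ t) ⟨
  2 * t          ≤⟨ *-monoˡ-≤ t 2≤r ⟩
  r * t          ≡⟨ *-assoc r (r ^ 4) c ⟨
  r ^ 5 * c      ∎
  where
  open ≤-Reasoning
  t : ℕ
  t = r ^ 4 * c

second-common-point : ∀ {n} {A : Family n} {u w p} → Independent A → A u → A w
                    → p ∈ u → p ∈ w → ∃ λ q → q ∈ u × q ∈ w × q ≢ p
second-common-point {u = u} {w} independent u∈A w∈A p∈u p∈w
  with another-element (u ∩ w) (x∈p∩q⁺ (p∈u , p∈w)) (independent u w u∈A w∈A)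
... | q , q∈u∩w , q≢p with x∈p∩q⁻ u w q∈u∩w
... | q∈u , q∈w = q , q∈u , q∈w , q≢p

module Setting {n k : ℕ} (A : Family n) (vs : Fin k → Subset n) (x : Fin n) where

  ∈B⇒∈A : ∀ {l v} → InB A vs x l v → A v
  ∈B⇒∈A ((v∈A , _) , _) = v∈A

  misses-other : ∀ {l l′ v a} → InB A vs x l v → l′ ≢ l → a ∈ v → a ∉ vs l′
  misses-other ((_ , _ , _ , _ , meets-only) , _ , meets-l) l′≢l a∈v a∈vl′ =
    l′≢l (trans (meets-only _ (_ , x∈p∩q⁺ (a∈v , a∈vl′))) (sym (meets-only _ meets-l)))

  ∈-f : ∀ {i f u a} → IsChoiceF A vs x i f → InB A vs x i u
      → a ∈ u → a ≢ x → a ∉ vs i → a ∈ f u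
  ∈-f {i} {f} {u} {a} choice u∈Bi a∈u a≢x a∉vi with choice u u∈Bi
  ... | y , z , _ , y∈ , z∈ , fu≡ =
    subst (a ∈_) (sym fu≡) (x∈p∧x≢y⇒x∈p-y (x∈p∧x≢y⇒x∈p-y (x∈p∧x≢y⇒x∈p-y a∈u a≢x) (avoids y∈)) (avoids z∈))
    where
    avoids : ∀ {y} → y ∈ u ∩ vs i → a ≢ y
    avoids y∈ refl = a∉vi (proj₂ (x∈p∩q⁻ u (vs i) y∈))

  Bⱼ-marked : ∀ {r f i j u₁ u₂ w}
            → 5 ≤ r → Vertices r A → Independent A → (∀ l → A (vs l)) → OutsideI₀ vs x
            → i ≢ j → IsChoiceF A vs x i f
            → InB A vs x i u₁ → InB A vs x i u₂ → Empty (f u₁ ∩ f u₂)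
            → InB A vs x j w → Marked (⁅ x ⁆ ∷ u₁ ∷ u₂ ∷ vs j ∷ vs j ∷ []) (r ∸ 5) w
  Bⱼ-marked {r} {f} {i} {j} {u₁} {u₂} {w} 5≤r vertices independent vs∈A x∉I₀ i≢j choice
            u₁∈Bᵢ@(_ , x∈u₁ , _) u₂∈Bᵢ@(_ , x∈u₂ , _) disjoint w∈Bⱼ@(_ , x∈w , c , c∈w∩vⱼ)
    with second-common-point independent (∈B⇒∈A w∈Bⱼ) (∈B⇒∈A u₁∈Bᵢ) x∈w x∈u₁
       | second-common-point independent (∈B⇒∈A w∈Bⱼ) (∈B⇒∈A u₂∈Bᵢ) x∈w x∈u₂
       | x∈p∩q⁻ w (vs j) c∈w∩vⱼ
  ... | a , a∈w , a∈u₁ , a≢x | b , b∈w , b∈u₂ , b≢x | c∈w , c∈vⱼ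
    with second-common-point independent (∈B⇒∈A w∈Bⱼ) (vs∈A j) c∈w c∈vⱼ
  ... | d , d∈w , d∈vⱼ , d≢c =
    (x ∷ a ∷ b ∷ c ∷ d ∷ []) , distinct ,
    (x∈⁅x⁆ x ∷ a∈u₁ ∷ b∈u₂ ∷ c∈vⱼ ∷ d∈vⱼ ∷ []) ,
    (x∈w ∷ a∈w ∷ b∈w ∷ c∈w ∷ d∈w ∷ []) ,
    trans (vertices w (∈B⇒∈A w∈Bⱼ)) (sym (m+[n∸m]≡n 5≤r))
    where
    x≢vⱼ : ∀ {q} → q ∈ vs j → x ≢ q
    x≢vⱼ q∈vⱼ refl = x∉I₀ j q∈vⱼ
    -- a and b lie in members of B_i, hence outside v_j
    a≢vⱼ : ∀ {q} → q ∈ vs j → a ≢ q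
    a≢vⱼ q∈vⱼ refl = misses-other u₁∈Bᵢ (≢-sym i≢j) a∈u₁ q∈vⱼ
    b≢vⱼ : ∀ {q} → q ∈ vs j → b ≢ q
    b≢vⱼ q∈vⱼ refl = misses-other u₂∈Bᵢ (≢-sym i≢j) b∈u₂ q∈vⱼ
    -- a and b lie in w ∈ B_j, hence outside v_i, so they survive in f(u₁), f(u₂)
    a∈fu₁ : a ∈ f u₁
    a∈fu₁ = ∈-f choice u₁∈Bᵢ a∈u₁ a≢x (misses-other w∈Bⱼ i≢j a∈w)
    b∈fu₂ : b ∈ f u₂
    b∈fu₂ = ∈-f choice u₂∈Bᵢ b∈u₂ b≢x (misses-other w∈Bⱼ i≢j b∈w)
    a≢b : a ≢ b
    a≢b refl = disjoint (a , x∈p∩q⁺ (a∈fu₁ , b∈fu₂))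
    distinct : Unique (x ∷ a ∷ b ∷ c ∷ d ∷ [])
    distinct = (≢-sym a≢x ∷ ≢-sym b≢x ∷ x≢vⱼ c∈vⱼ ∷ x≢vⱼ d∈vⱼ ∷ [])
             ∷ (a≢b ∷ a≢vⱼ c∈vⱼ ∷ a≢vⱼ d∈vⱼ ∷ [])
             ∷ (b≢vⱼ c∈vⱼ ∷ b≢vⱼ d∈vⱼ ∷ [])
             ∷ (≢-sym d≢c ∷ [])
             ∷ [] ∷ []

lemma7 : (n r k : ℕ) → 5 ≤ r → (A : Family n) → Vertices r A → Independent A
    → (vs : Fin k → Subset n) → IsMaxDisjoint A vs
    → (x : Fin n) → OutsideI₀ vs x
    → (f : Subset n → Subset n)
    → (i j : Fin k) → i ≢ j
    → IsChoiceF A vs x i f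
    → (∃ λ v → InB A vs x i v) → AtLeast (ω n r) (InB A vs x j)
    → ∀ u₁ u₂ → InB A vs x i u₁ → InB A vs x i u₂ → Nonempty (f u₁ ∩ f u₂)
lemma7 n r k 5≤r A vertices independent vs (vs∈A , _ , _) x x∉I₀ f i j i≢j choice _ Bⱼ-large
       u₁ u₂ u₁∈Bᵢ u₂∈Bᵢ with nonempty? (f u₁ ∩ f u₂)
... | yes meet    = meet
... | no disjoint = ⊥-elim (<⇒≱ (r⁴c<r⁵c (≤-trans (s≤s (s≤s z≤n)) 5≤r) (1≤nCk r∸5≤n)) ω≤r⁴c)
  where
  open Setting A vs x
  pools : List (Subset n)
  pools = ⁅ x ⁆ ∷ u₁ ∷ u₂ ∷ vs j ∷ vs j ∷ []
  ∣u₁∣≡r : ∣ u₁ ∣ ≡ r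
  ∣u₁∣≡r = vertices u₁ (∈B⇒∈A u₁∈Bᵢ)
  r∸5≤n : r ∸ 5 ≤ n
  r∸5≤n = ≤-trans (m∸n≤m r 5) (subst (_≤ n) ∣u₁∣≡r (∣p∣≤n u₁))
  product-pools : product (map ∣_∣ pools) ≡ r ^ 4
  product-pools rewrite ∣⁅x⁆∣≡1 x | ∣u₁∣≡r | vertices u₂ (∈B⇒∈A u₂∈Bᵢ) | vertices (vs j) (vs∈A j) =
    *-identityˡ (r ^ 4)
  ω≤r⁴c : ω n r ≤ r ^ 4 * (n C (r ∸ 5))
  ω≤r⁴c = subst (λ t → ω n r ≤ t * (n C (r ∸ 5))) product-pools
            (encoding-bound (InB A vs x j) pools (r ∸ 5)
              (λ w → Bⱼ-marked 5≤r vertices independent vs∈A x∉I₀ i≢j choice u₁∈Bᵢ u₂∈Bᵢ disjoint)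
              Bⱼ-large)
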